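{- Let $G$ be a tree. Then $G$ is a trapezoid graph if and only if $G$ is a caterpillar.
   Context: A trapezoid graph is the intersection graph of a finite set of trapezoids, each having two corner points on each of two fixed horizontal parallel lines (upper corners $a[i]\le b[i]$, lower corners $c[i]\le d[i]$), with no two trapezoids sharing a corner point; vertices correspond to trapezoids and two vertices are adjacent iff their trapezoids intersect. A caterpillar is a tree such that removing all its pendent vertices (leaves) and their incident edges leaves a path.
   Formalization: The corner points of the trapezoids on the two horizontal lines have rational coordinates. -}

module Defs where

open import Data.Nat using (ℕ; _≤_)
open import Data.Bool using (Bool; true; false)
open import Data.Fin using (Fin)
open import Data.List using (List; []; _∷_; _++_; [_]; length; filterᵇ; allFin)
open import Data.List.Relation.Unary.Unique.Propositional using (Unique)
open import Data.List.Membership.Propositional using (_∈_)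
open import Data.Product using (Σ; ∃; _×_; _,_)
open import Data.Sum using (_⊎_)
open import Data.Unit using (⊤)
open import Relation.Nullary using (¬_)
open import Relation.Binary.PropositionalEquality using (_≡_; _≢_)
open import Function.Bundles using (_⇔_)
open import Data.Rational using (ℚ; 0ℚ; 1ℚ; _+_; _*_; _-_) renaming (_≤_ to _≤q_; _<_ to _<q_)

record Graph (n : ℕ) : Set where
  field
    adj     : Fin n → Fin n → Bool
    symm    : ∀ u v → adj u v ≡ adj v u
    irrefl  : ∀ v → adj v v ≡ false
open Graph public

module _ {n : ℕ} (G : Graph n) where

  Adj : Fin n → Fin n → Set
  Adj u v = adj G u v ≡ true

  data Reach : Fin n → Fin n → Set where
    here : ∀ {u} → Reach u u
    step : ∀ {u w v} → Adj u w → Reach w v → Reach u v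

  Connected : Set
  Connected = ∀ u v → Reach u v

  Consec : List (Fin n) → Set
  Consec []            = ⊤
  Consec (x ∷ [])      = ⊤
  Consec (x ∷ y ∷ r)   = Adj x y × Consec (y ∷ r)

  HasCycle : Set
  HasCycle = Σ (Fin n) λ u → Σ (List (Fin n)) λ ws →
               (2 ≤ length ws) × Unique (u ∷ ws) × Consec (u ∷ ws ++ [ u ])

  Tree : Set
  Tree = (1 ≤ n) × Connected × ¬ HasCycle

  degree : Fin n → ℕ
  degree v = length (filterᵇ (adj G v) (allFin n))

  Leaf : Fin n → Set
  Leaf v = degree v ≡ 1

  ConsecutiveIn : Fin n → Fin n → List (Fin n) → Set
  ConsecutiveIn u v p = Σ (List (Fin n)) λ xs → Σ (List (Fin n)) λ ys →
    (p ≡ xs ++ u ∷ v ∷ ys) ⊎ (p ≡ xs ++ v ∷ u ∷ ys)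

  -- removing all leaves leaves a path: the induced subgraph on the
  -- non-leaf vertices is a path graph v₁ – v₂ – … – vₖ (k ≥ 0)
  LeafDeletionIsPath : Set
  LeafDeletionIsPath = Σ (List (Fin n)) λ p →
      Unique p
    × (∀ v → (v ∈ p) ⇔ (¬ Leaf v))
    × (∀ u v → u ∈ p → v ∈ p → Adj u v ⇔ ConsecutiveIn u v p)

  Caterpillar : Set
  Caterpillar = Tree × LeafDeletionIsPath

-- Trapezoids between the lines y = 1 (upper) and y = 0 (lower).
-- Trapezoid i has upper corners a i ≤ b i and lower corners c i ≤ d i.

record TrapezoidFamily (n : ℕ) : Set where
  field
    a b c d : Fin n → ℚ
open TrapezoidFamily public

module _ {n : ℕ} (T : TrapezoidFamily n) where

  InTrapezoid : Fin n → ℚ → ℚ → Set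
  InTrapezoid i x t =
      (0ℚ ≤q t) × (t ≤q 1ℚ)
    × (((1ℚ - t) * c T i + t * a T i) ≤q x)
    × (x ≤q ((1ℚ - t) * d T i + t * b T i))

  Intersect : Fin n → Fin n → Set
  Intersect i j = Σ ℚ λ x → Σ ℚ λ t → InTrapezoid i x t × InTrapezoid j x t

  ValidFamily : Set
  ValidFamily =
      (∀ i → a T i ≤q b T i) × (∀ i → c T i ≤q d T i)
    × (∀ i j → i ≢ j →
         a T i ≢ a T j × a T i ≢ b T j × b T i ≢ a T j × b T i ≢ b T j
       × c T i ≢ c T j × c T i ≢ d T j × d T i ≢ c T j × d T i ≢ d T j)

TrapezoidGraph : ∀ {n} → Graph n → Set
TrapezoidGraph {n} G = Σ (TrapezoidFamily n) λ T →
  ValidFamily T × (∀ i j → i ≢ j → Adj G i j ⇔ Intersect T i j)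

-- Two disjoint trapezoids are separated: one lies to the left of the other on both lines, for
-- otherwise the right edge of one crosses the left edge of the other.  Hence "lies left of" is a
-- strict order comparing exactly the non-adjacent pairs, and a trapezoid graph has no asteroidal
-- triple: a walk that avoids the closed neighbourhood of z cannot get from one side of z to the
-- other.  In a tree, a vertex with three non-leaf neighbours is the centre of a subdivided claw,
-- whose three feet form an asteroidal triple.  So every vertex of such a tree has at most two
-- non-leaf neighbours, and a maximal path of non-leaves grown from an end of another maximal path
-- contains every non-leaf: it is the spine.  Conversely a caterpillar is an interval graph (a chain
-- of intervals for the spine, a point inside its neighbour's interval for each leaf), and intervals
-- are degenerate trapezoids.

module Submission where

open import Defs
open import Level using (0ℓ)
open import Data.Nat as ℕ using (ℕ; zero; suc; _+_; _*_; _≤_; _<_; s≤s; z≤n)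
open import Data.Nat.Properties hiding (_≟_)
open import Data.Integer as ℤ using (+_)
import Data.Integer.Properties as ℤ
open import Data.Bool as Bool using (true)
open import Data.Bool.Properties using (T-≡)
open import Data.Fin using (Fin; toℕ; _≟_)
open import Data.Fin.Properties using (any?; toℕ<n; toℕ-injective)
open import Data.List using (List; []; _∷_; _++_; [_]; length; filterᵇ; allFin)
open import Data.List.Properties using (++-assoc; length-++; length-tabulate; ∷-injectiveˡ)
open import Data.List.Relation.Unary.All using (All; []; _∷_)
import Data.List.Relation.Unary.All as All
open import Data.List.Relation.Unary.All.Properties using (++⁻ˡ; ¬Any⇒All¬)
open import Data.List.Relation.Unary.AllPairs using ([]; _∷_)
open import Data.List.Relation.Unary.Any using (here; there)
open import Data.List.Relation.Unary.Unique.Propositional using (Unique)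
import Data.List.Relation.Unary.Unique.Propositional.Properties as Unique
open import Data.List.Membership.Propositional using (_∈_; _∉_)
open import Data.List.Membership.Propositional.Properties
  using (∈-filter⁺; ∈-filter⁻; ∈-allFin; ∈-∃++; ∈-++⁺ˡ; ∈-++⁺ʳ; ∈-++⁻)
import Data.List.Membership.DecPropositional as DecMembership
open import Data.Rational as ℚ
  using (ℚ; 0ℚ; 1ℚ; *≤*; ↥_; NonZero; Positive; NonNegative; positive; nonNegative)
import Data.Rational.Properties as ℚ
open import Data.Rational.Literals using (fromℤ)
open import Data.Rational.Solver using (module +-*-Solver)
open +-*-Solver using (solve; _:=_; con; _:+_; _:*_; _:-_)
open import Data.Product using (∃; ∃₂; _×_; _,_; proj₁; proj₂; map₂; swap)
open import Data.Sum using (_⊎_; inj₁; inj₂)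
import Data.Sum as Sum
open import Data.Unit using (⊤; tt)
open import Data.Empty using (⊥; ⊥-elim)
open import Relation.Nullary using (¬_; Dec; yes; no)
open import Relation.Nullary.Decidable using (T?; ¬?; _×-dec_)
open import Relation.Binary.Definitions using (DecidableEquality; tri<; tri≈; tri>)
open import Relation.Binary.PropositionalEquality hiding ([_])
import Relation.Binary.Reasoning.Setoid as SetoidReasoning
open import Function.Base using (_∘_; flip)
open import Function.Bundles using (_⇔_; Equivalence; mk⇔)
open import Function.Properties.Equivalence using (⇔-setoid)

module ⇔-Reasoning = SetoidReasoning (⇔-setoid 0ℓ)

module _ {A : Set} where

  Unique-++⁻ˡ : ∀ xs {ys : List A} → Unique (xs ++ ys) → Unique xs
  Unique-++⁻ˡ []       _           = []
  Unique-++⁻ˡ (x ∷ xs) (x∉ ∷ uniq) = ++⁻ˡ xs x∉ ∷ Unique-++⁻ˡ xs uniq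

  Unique-++⁻ʳ : ∀ xs {ys : List A} → Unique (xs ++ ys) → Unique ys
  Unique-++⁻ʳ []       uniq       = uniq
  Unique-++⁻ʳ (_ ∷ xs) (_ ∷ uniq) = Unique-++⁻ʳ xs uniq

  Unique⇒length≤ : ∀ {xs ys : List A} → Unique xs → (∀ {x} → x ∈ xs → x ∈ ys) →
                   length xs ≤ length ys
  Unique⇒length≤ {[]}     _            _   = z≤n
  Unique⇒length≤ {x ∷ xs} (x∉ ∷ uniq) xs⊆ with ys₁ , ys₂ , refl ← ∈-∃++ (xs⊆ (here refl)) =
    ≤-trans (s≤s (Unique⇒length≤ uniq xs⊆ys₁ys₂))
            (≤-reflexive (sym (length-++-∷ ys₁)))
    where
    length-++-∷ : ∀ zs {z ws} → length (zs ++ z ∷ ws) ≡ suc (length (zs ++ ws))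
    length-++-∷ []       = refl
    length-++-∷ (_ ∷ zs) = cong suc (length-++-∷ zs)
    xs⊆ys₁ys₂ : ∀ {z} → z ∈ xs → z ∈ ys₁ ++ ys₂
    xs⊆ys₁ys₂ z∈xs with ∈-++⁻ ys₁ (xs⊆ (there z∈xs))
    ... | inj₁ z∈ys₁         = ∈-++⁺ˡ z∈ys₁
    ... | inj₂ (here refl)   = ⊥-elim (All.lookup x∉ z∈xs refl)
    ... | inj₂ (there z∈ys₂) = ∈-++⁺ʳ ys₁ z∈ys₂

  Before : A → A → List A → Set
  Before u v xs = ∃₂ λ ys zs → xs ≡ ys ++ u ∷ zs × v ∈ zs

  ∈-ordered : ∀ {u v : A} {xs} → u ∈ xs → v ∈ xs → u ≢ v → Before u v xs ⊎ Before v u xs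
  ∈-ordered (here refl) (here refl) u≢v = ⊥-elim (u≢v refl)
  ∈-ordered (here refl) (there v∈)  _   = inj₁ ([] , _ , refl , v∈)
  ∈-ordered (there u∈)  (here refl) _   = inj₂ ([] , _ , refl , u∈)
  ∈-ordered {xs = x ∷ _} (there u∈) (there v∈) u≢v =
    Sum.map cons cons (∈-ordered u∈ v∈ u≢v)
    where
    cons : ∀ {a b} → Before a b _ → Before a b (x ∷ _)
    cons (ys , zs , refl , b∈) = x ∷ ys , zs , refl , b∈

  length≡1⇒∈-unique : ∀ {xs : List A} {x y} → length xs ≡ 1 → x ∈ xs → y ∈ xs → x ≡ y
  length≡1⇒∈-unique {_ ∷ []} _ (here refl) (here refl) = refl

  length≡1⇒∃∈ : ∀ {xs : List A} → length xs ≡ 1 → ∃ (_∈ xs)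
  length≡1⇒∃∈ {x ∷ []} _ = x , here refl

  Unique⇒∃other : ∀ {xs : List A} {x} → Unique xs → x ∈ xs → length xs ≢ 1 →
                  ∃ λ y → y ∈ xs × y ≢ x
  Unique⇒∃other {_ ∷ []}    _                  _            len≢1 = ⊥-elim (len≢1 refl)
  Unique⇒∃other {_ ∷ y ∷ _} ((x≢y ∷ _) ∷ _) (here refl) _     = y , there (here refl) , ≢-sym x≢y
  Unique⇒∃other {x ∷ _ ∷ _} (x∉ ∷ _)       (there y∈) _     = x , here refl , λ x≡y → All.lookup x∉ y∈ x≡y

Unique⇒length≤ₙ : ∀ {n} {xs : List (Fin n)} → Unique xs → length xs ≤ n
Unique⇒length≤ₙ {n} uniq =
  ≤-trans (Unique⇒length≤ uniq (λ {x} _ → ∈-allFin x)) (≤-reflexive (length-tabulate {n = n} (λ i → i)))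

-- Graphs, leaves and cycles

module _ {n : ℕ} (G : Graph n) where

  Adj-sym : ∀ {u v} → Adj G u v → Adj G v u
  Adj-sym {u} {v} uv = trans (symm G v u) uv

  Adj⇒≢ : ∀ {u v} → Adj G u v → u ≢ v
  Adj⇒≢ {u} uu refl with trans (sym uu) (irrefl G u)
  ... | ()

  Adj? : ∀ u v → Dec (Adj G u v)
  Adj? u v = adj G u v Bool.≟ true

  Reach-preserves : ∀ (P : Fin n → Set) → (∀ {u v} → P u → Adj G u v → P v) →
                    ∀ {u v} → Reach G u v → P u → P v
  Reach-preserves P closed here          Pu = Pu
  Reach-preserves P closed (step uw w⇝v) Pu = Reach-preserves P closed w⇝v (closed Pu uw)

  Consec-++⁻ˡ : ∀ xs {ys} → Consec G (xs ++ ys) → Consec G xs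
  Consec-++⁻ˡ []           _           = tt
  Consec-++⁻ˡ (x ∷ [])     _           = tt
  Consec-++⁻ˡ (x ∷ y ∷ xs) (xy , rest) = xy , Consec-++⁻ˡ (y ∷ xs) rest

  Consec-++⁻ʳ : ∀ xs {ys} → Consec G (xs ++ ys) → Consec G ys
  Consec-++⁻ʳ []                    c        = c
  Consec-++⁻ʳ (x ∷ [])     {[]}     _        = tt
  Consec-++⁻ʳ (x ∷ [])     {_ ∷ _}  (_ , c)  = c
  Consec-++⁻ʳ (x ∷ y ∷ xs)          (_ , c)  = Consec-++⁻ʳ (y ∷ xs) c

  Consec-∷ʳ : ∀ xs {x y} → Consec G (xs ++ [ x ]) → Adj G x y → Consec G (xs ++ x ∷ [ y ])
  Consec-∷ʳ []           _           xy = xy , tt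
  Consec-∷ʳ (z ∷ [])     (zx , _)    xy = zx , xy , tt
  Consec-∷ʳ (z ∷ w ∷ xs) (zw , rest) xy = zw , Consec-∷ʳ (w ∷ xs) rest xy

  Consec⇒Adj : ∀ xs {u v ys} → Consec G (xs ++ u ∷ v ∷ ys) → Adj G u v
  Consec⇒Adj []           (uv , _) = uv
  Consec⇒Adj (x ∷ [])     (_ , c)  = Consec⇒Adj [] c
  Consec⇒Adj (x ∷ y ∷ xs) (_ , c)  = Consec⇒Adj (y ∷ xs) c

  ConsecutiveIn⇒Adj : ∀ {u v p} → Consec G p → ConsecutiveIn G u v p → Adj G u v
  ConsecutiveIn⇒Adj c (xs , _ , inj₁ refl) = Consec⇒Adj xs c
  ConsecutiveIn⇒Adj c (xs , _ , inj₂ refl) = Adj-sym (Consec⇒Adj xs c)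

module _ {n : ℕ} (G : Graph n) where

  neighbours : Fin n → List (Fin n)
  neighbours v = filterᵇ (adj G v) (allFin n)

  Adj⇒∈neighbours : ∀ {v w} → Adj G v w → w ∈ neighbours v
  Adj⇒∈neighbours {v} {w} vw = ∈-filter⁺ (T? ∘ adj G v) (∈-allFin w) (Equivalence.from T-≡ vw)

  ∈neighbours⇒Adj : ∀ {v w} → w ∈ neighbours v → Adj G v w
  ∈neighbours⇒Adj {v} w∈ = Equivalence.to T-≡ (proj₂ (∈-filter⁻ (T? ∘ adj G v) {xs = allFin n} w∈))

  neighbours-unique : ∀ v → Unique (neighbours v)
  neighbours-unique v = Unique.filter⁺ (T? ∘ adj G v) (Unique.allFin⁺ n)

  Leaf? : ∀ v → Dec (Leaf G v)
  Leaf? v = degree G v ℕ.≟ 1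

  Leaf⇒Adj-unique : ∀ {v w w′} → Leaf G v → Adj G v w → Adj G v w′ → w ≡ w′
  Leaf⇒Adj-unique leaf vw vw′ = length≡1⇒∈-unique leaf (Adj⇒∈neighbours vw) (Adj⇒∈neighbours vw′)

  Leaf⇒∃Adj : ∀ {v} → Leaf G v → ∃ (Adj G v)
  Leaf⇒∃Adj leaf = map₂ ∈neighbours⇒Adj (length≡1⇒∃∈ leaf)

  ¬Leaf⇒∃otherAdj : ∀ {v u} → ¬ Leaf G v → Adj G v u → ∃ λ w → Adj G v w × w ≢ u
  ¬Leaf⇒∃otherAdj {v} ¬leaf vu
    with w , w∈ , w≢u ← Unique⇒∃other (neighbours-unique v) (Adj⇒∈neighbours vu) ¬leaf =
    w , ∈neighbours⇒Adj w∈ , w≢u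

  adjacent-leaves-cover : Connected G → ∀ {u v} → Leaf G u → Leaf G v → Adj G u v →
                          ∀ w → w ≡ u ⊎ w ≡ v
  adjacent-leaves-cover connected {u} {v} leafu leafv uv w =
    Reach-preserves G (λ x → x ≡ u ⊎ x ≡ v) closed (connected u w) (inj₁ refl)
    where
    closed : ∀ {x y} → x ≡ u ⊎ x ≡ v → Adj G x y → y ≡ u ⊎ y ≡ v
    closed (inj₁ refl) uy = inj₂ (Leaf⇒Adj-unique leafu uy uv)
    closed (inj₂ refl) vy = inj₁ (Leaf⇒Adj-unique leafv vy (Adj-sym G uv))

module Acyclic {n : ℕ} {G : Graph n} (acyclic : ¬ HasCycle G) where

  triangle : ∀ {u a b} → Adj G u a → Adj G a b → Adj G b u → ⊥
  triangle ua ab bu = acyclic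
    (_ , _ ∷ _ ∷ [] , s≤s (s≤s z≤n) ,
     (Adj⇒≢ G ua ∷ ≢-sym (Adj⇒≢ G bu) ∷ []) ∷ (Adj⇒≢ G ab ∷ []) ∷ [] ∷ [] ,
     ua , ab , bu , tt)

  square : ∀ {u a b c} → Adj G u a → Adj G a b → Adj G b c → Adj G c u →
           u ≢ b → a ≢ c → ⊥
  square ua ab bc cu u≢b a≢c = acyclic
    (_ , _ ∷ _ ∷ _ ∷ [] , s≤s (s≤s z≤n) ,
     (Adj⇒≢ G ua ∷ u≢b ∷ ≢-sym (Adj⇒≢ G cu) ∷ []) ∷ (Adj⇒≢ G ab ∷ a≢c ∷ []) ∷
     (Adj⇒≢ G bc ∷ []) ∷ [] ∷ [] ,
     ua , ab , bc , cu , tt)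

  pentagon : ∀ {u a b c d} → Adj G u a → Adj G a b → Adj G b c → Adj G c d → Adj G d u →
             u ≢ b → u ≢ c → a ≢ c → a ≢ d → b ≢ d → ⊥
  pentagon ua ab bc cd du u≢b u≢c a≢c a≢d b≢d = acyclic
    (_ , _ ∷ _ ∷ _ ∷ _ ∷ [] , s≤s (s≤s z≤n) ,
     (Adj⇒≢ G ua ∷ u≢b ∷ u≢c ∷ ≢-sym (Adj⇒≢ G du) ∷ []) ∷ (Adj⇒≢ G ab ∷ a≢c ∷ a≢d ∷ []) ∷
     (Adj⇒≢ G bc ∷ b≢d ∷ []) ∷ (Adj⇒≢ G cd ∷ []) ∷ [] ∷ [] ,
     ua , ab , bc , cd , du , tt)

  chord : ∀ {u v} y ys {zs} → Unique (u ∷ y ∷ ys ++ v ∷ zs) → Consec G (u ∷ y ∷ ys ++ v ∷ zs) →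
          Adj G v u → ⊥
  chord {u} {v} y ys {zs} uniq consec vu = acyclic
    (u , y ∷ ys ++ [ v ] , s≤s (subst (1 ≤_) (sym (length-++ ys)) (m≤n+m 1 (length ys))) ,
     Unique-++⁻ˡ (u ∷ y ∷ ys ++ [ v ]) (subst (λ l → Unique (u ∷ y ∷ l)) (sym assoc) uniq) ,
     subst (λ l → Consec G (u ∷ y ∷ l)) (sym (++-assoc ys [ v ] [ u ]))
       (Consec-∷ʳ G (u ∷ y ∷ ys)
         (Consec-++⁻ˡ G (u ∷ y ∷ ys ++ [ v ]) (subst (λ l → Consec G (u ∷ y ∷ l)) (sym assoc) consec))
         vu))
    where
    assoc : (ys ++ [ v ]) ++ zs ≡ ys ++ v ∷ zs
    assoc = ++-assoc ys [ v ] zs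

  Adj⇒next : ∀ {u v t} → Unique (u ∷ t) → Consec G (u ∷ t) → Adj G u v → v ∈ t →
             ∃ λ zs → t ≡ v ∷ zs
  Adj⇒next {t = t} uniq consec uv v∈t with ∈-∃++ v∈t
  ... | []     , zs , refl = zs , refl
  ... | y ∷ ys , zs , refl = ⊥-elim (chord y ys uniq consec (Adj-sym G uv))

  Adj⇔ConsecutiveIn : ∀ {p u v} → Unique p → Consec G p → u ∈ p → v ∈ p →
                      Adj G u v ⇔ ConsecutiveIn G u v p
  Adj⇔ConsecutiveIn {p} {u} {v} uniq consec u∈ v∈ = mk⇔ to (ConsecutiveIn⇒Adj G consec)
    where
    next : ∀ {a b} → Adj G a b → Before a b p → ∃₂ λ xs ys → p ≡ xs ++ a ∷ b ∷ ys
    next ab (xs , t , refl , b∈t) with zs , refl ←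
      Adj⇒next (Unique-++⁻ʳ xs uniq) (Consec-++⁻ʳ G xs consec) ab b∈t = xs , zs , refl
    to : Adj G u v → ConsecutiveIn G u v p
    to uv with ∈-ordered u∈ v∈ (Adj⇒≢ G uv)
    ... | inj₁ u<v with xs , ys , p≡ ← next uv u<v = xs , ys , inj₁ p≡
    ... | inj₂ v<u with xs , ys , p≡ ← next (Adj-sym G uv) v<u = xs , ys , inj₂ p≡

-- Cocomparability orders and asteroidal triples

record CocomparabilityOrder {n : ℕ} (G : Graph n) : Set₁ where
  field
    _≺_      : Fin n → Fin n → Set
    ≺-irrefl : ∀ {i} → ¬ (i ≺ i)
    ≺-trans  : ∀ {i j k} → i ≺ j → j ≺ k → i ≺ k
    ≺⇒¬Adj   : ∀ {i j} → i ≺ j → ¬ Adj G i j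
    ¬Adj⇒≺   : ∀ {i j} → i ≢ j → ¬ Adj G i j → i ≺ j ⊎ j ≺ i

module _ {n : ℕ} (G : Graph n) where

  Far : Fin n → Fin n → Set
  Far z v = v ≢ z × ¬ Adj G v z

  infixr 5 _∷⟨_⟩_
  data AvoidingWalk (z : Fin n) : Fin n → Fin n → Set where
    stop   : ∀ {u} → Far z u → AvoidingWalk z u u
    _∷⟨_⟩_ : ∀ {u w v} → Far z u → Adj G u w → AvoidingWalk z w v → AvoidingWalk z u v

  AvoidingWalk-start : ∀ {z u v} → AvoidingWalk z u v → Far z u
  AvoidingWalk-start (stop far)   = far
  AvoidingWalk-start (far ∷⟨ _ ⟩ _) = far

  AvoidingWalk-end : ∀ {z u v} → AvoidingWalk z u v → Far z v
  AvoidingWalk-end (stop far)   = far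
  AvoidingWalk-end (_ ∷⟨ _ ⟩ w) = AvoidingWalk-end w

  record AsteroidalTriple (x y z : Fin n) : Set where
    field
      x⇝y : AvoidingWalk z x y
      y⇝z : AvoidingWalk x y z
      z⇝x : AvoidingWalk y z x

  open AsteroidalTriple public

  flipOrder : CocomparabilityOrder G → CocomparabilityOrder G
  flipOrder O = record
    { _≺_      = flip _≺_
    ; ≺-irrefl = ≺-irrefl
    ; ≺-trans  = flip ≺-trans
    ; ≺⇒¬Adj   = λ j≺i ij → ≺⇒¬Adj j≺i (Adj-sym G ij)
    ; ¬Adj⇒≺   = λ i≢j ¬ij → Sum.swap (¬Adj⇒≺ i≢j ¬ij)
    }
    where open CocomparabilityOrder O

  module _ (O : CocomparabilityOrder G) where
    open CocomparabilityOrder O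

    compare-far : ∀ {z v} → Far z v → z ≺ v ⊎ v ≺ z
    compare-far (v≢z , ¬vz) = ¬Adj⇒≺ (≢-sym v≢z) (λ zv → ¬vz (Adj-sym G zv))

    ≺-along : ∀ {z u v} → z ≺ u → AvoidingWalk z u v → z ≺ v
    ≺-along z≺u (stop _) = z≺u
    ≺-along z≺u (_ ∷⟨ uw ⟩ walk) with compare-far (AvoidingWalk-start walk)
    ... | inj₁ z≺w = ≺-along z≺w walk
    ... | inj₂ w≺z = ⊥-elim (≺⇒¬Adj (≺-trans w≺z z≺u) (Adj-sym G uw))

    ¬between : ∀ {a b c} → a ≺ b → b ≺ c → ¬ AvoidingWalk b c a
    ¬between a≺b b≺c walk = ≺-irrefl (≺-trans a≺b (≺-along b≺c walk))

  -- one of x, y, z lies between the other two, and the walk joining those two avoids it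
  ¬AsteroidalTriple-≺ : (O : CocomparabilityOrder G) → ∀ {x y z} →
                        CocomparabilityOrder._≺_ O x y → ¬ AsteroidalTriple x y z
  ¬AsteroidalTriple-≺ O x≺y at
    with compare-far O (AvoidingWalk-start (z⇝x at)) | compare-far O (AvoidingWalk-end (y⇝z at))
  ... | inj₁ y≺z | _        = ¬between O x≺y y≺z (z⇝x at)
  ... | inj₂ z≺y | inj₁ x≺z = ¬between (flipOrder O) z≺y x≺z (x⇝y at)
  ... | inj₂ z≺y | inj₂ z≺x = ¬between O z≺x x≺y (y⇝z at)

  ¬AsteroidalTriple : CocomparabilityOrder G → ∀ {x y z} → ¬ AsteroidalTriple x y z
  ¬AsteroidalTriple O at with compare-far O (AvoidingWalk-start (y⇝z at))
  ... | inj₁ x≺y = ¬AsteroidalTriple-≺ O x≺y at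
  ... | inj₂ y≺x = ¬AsteroidalTriple-≺ (flipOrder O) y≺x at

module _ {n : ℕ} (G : Graph n) where

  NonLeafNbr : Fin n → Fin n → Set
  NonLeafNbr v w = Adj G v w × ¬ Leaf G w

  AtMostTwoNonLeafNbrs : Set
  AtMostTwoNonLeafNbrs = ∀ {v x₁ x₂ x₃} → NonLeafNbr v x₁ → NonLeafNbr v x₂ → NonLeafNbr v x₃ →
                         x₁ ≢ x₂ → x₁ ≢ x₃ → x₂ ≢ x₃ → ⊥

module Arms {n : ℕ} {G : Graph n} (acyclic : ¬ HasCycle G) where
  open Acyclic acyclic

  record Arm (v : Fin n) : Set where
    field
      {knee foot} : Fin n
      v-knee      : Adj G v knee
      knee-foot   : Adj G knee foot
      foot≢v      : foot ≢ v
  open Arm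

  nonLeafNbr⇒Arm : ∀ {v x} → NonLeafNbr G v x → Arm v
  nonLeafNbr⇒Arm (vx , ¬leaf) with y , xy , y≢v ← ¬Leaf⇒∃otherAdj G ¬leaf (Adj-sym G vx) =
    record { v-knee = vx ; knee-foot = xy ; foot≢v = y≢v }

  far-centre : ∀ {v} (B : Arm v) → Far G (foot B) v
  far-centre B = ≢-sym (foot≢v B) , λ vf → triangle (v-knee B) (knee-foot B) (Adj-sym G vf)

  far-knee : ∀ {v} (A B : Arm v) → knee A ≢ knee B → Far G (foot B) (knee A)
  far-knee A B knees≢ =
    (λ kA≡fB → triangle (v-knee A)
                 (subst (λ z → Adj G z (knee B)) (sym kA≡fB) (Adj-sym G (knee-foot B)))
                 (Adj-sym G (v-knee B))) ,
    (λ kA-fB → square (v-knee A) kA-fB (Adj-sym G (knee-foot B)) (Adj-sym G (v-knee B))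
                 (≢-sym (foot≢v B)) knees≢)

  far-foot : ∀ {v} (A B : Arm v) → knee A ≢ knee B → Far G (foot B) (foot A)
  far-foot A B knees≢ =
    (λ fA≡fB → square (v-knee A) (knee-foot A)
                 (subst (λ z → Adj G z (knee B)) (sym fA≡fB) (Adj-sym G (knee-foot B)))
                 (Adj-sym G (v-knee B)) (≢-sym (foot≢v A)) knees≢) ,
    (λ fA-fB → pentagon (v-knee A) (knee-foot A) fA-fB (Adj-sym G (knee-foot B)) (Adj-sym G (v-knee B))
                 (≢-sym (foot≢v A)) (≢-sym (foot≢v B)) (proj₁ (far-knee A B knees≢)) knees≢
                 (≢-sym (proj₁ (far-knee B A (≢-sym knees≢)))))

  arms-walk : ∀ {v} (A B C : Arm v) → knee A ≢ knee B → knee C ≢ knee B →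
              AvoidingWalk G (foot B) (foot A) (foot C)
  arms-walk A B C A≢B C≢B =
    far-foot A B A≢B ∷⟨ Adj-sym G (knee-foot A) ⟩ far-knee A B A≢B ∷⟨ Adj-sym G (v-knee A) ⟩
    far-centre B ∷⟨ v-knee C ⟩ far-knee C B C≢B ∷⟨ knee-foot C ⟩ stop (far-foot C B C≢B)

  arms-asteroidal : ∀ {v} (A B C : Arm v) → knee A ≢ knee B → knee A ≢ knee C → knee B ≢ knee C →
                    AsteroidalTriple G (foot A) (foot B) (foot C)
  arms-asteroidal A B C A≢B A≢C B≢C = record
    { x⇝y = arms-walk A C B A≢C B≢C
    ; y⇝z = arms-walk B A C (≢-sym A≢B) (≢-sym A≢C)
    ; z⇝x = arms-walk C B A (≢-sym B≢C) A≢B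
    }

  AT-free⇒AtMostTwoNonLeafNbrs : (∀ {x y z} → ¬ AsteroidalTriple G x y z) → AtMostTwoNonLeafNbrs G
  AT-free⇒AtMostTwoNonLeafNbrs AT-free vx₁ vx₂ vx₃ x₁≢x₂ x₁≢x₃ x₂≢x₃ =
    AT-free (arms-asteroidal (nonLeafNbr⇒Arm vx₁) (nonLeafNbr⇒Arm vx₂) (nonLeafNbr⇒Arm vx₃)
              x₁≢x₂ x₁≢x₃ x₂≢x₃)

-- Trapezoid graphs are cocomparability graphs

-- the point at height t on the segment from (p , 0) to (q , 1)
mix : ℚ → ℚ → ℚ → ℚ
mix t p q = (1ℚ ℚ.- t) ℚ.* p ℚ.+ t ℚ.* q

mix-0 : ∀ p q → mix 0ℚ p q ≡ p
mix-0 = solve 2 (λ p q → (con 1ℚ :- con 0ℚ) :* p :+ con 0ℚ :* q := p) refl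

mix-1 : ∀ p q → mix 1ℚ p q ≡ q
mix-1 = solve 2 (λ p q → (con 1ℚ :- con 1ℚ) :* p :+ con 1ℚ :* q := q) refl

p≤q⇒0≤q-p : ∀ {p q} → p ℚ.≤ q → 0ℚ ℚ.≤ q ℚ.- p
p≤q⇒0≤q-p {p} {q} p≤q = subst (ℚ._≤ q ℚ.- p) (ℚ.+-inverseʳ p) (ℚ.+-monoˡ-≤ (ℚ.- p) p≤q)

p<q⇒0<q-p : ∀ {p q} → p ℚ.< q → 0ℚ ℚ.< q ℚ.- p
p<q⇒0<q-p {p} {q} p<q = subst (ℚ._< q ℚ.- p) (ℚ.+-inverseʳ p) (ℚ.+-monoˡ-< (ℚ.- p) p<q)

module _ {t : ℚ} (0≤t : 0ℚ ℚ.≤ t) (t≤1 : t ℚ.≤ 1ℚ) where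

  mix-mono-≤ : ∀ {p p′ q q′} → p ℚ.≤ p′ → q ℚ.≤ q′ → mix t p q ℚ.≤ mix t p′ q′
  mix-mono-≤ p≤p′ q≤q′ =
    ℚ.+-mono-≤ (ℚ.*-monoˡ-≤-nonNeg (1ℚ ℚ.- t) {{nonNegative (p≤q⇒0≤q-p t≤1)}} p≤p′)
               (ℚ.*-monoˡ-≤-nonNeg t {{nonNegative 0≤t}} q≤q′)

  mix-mono-< : ∀ {p p′ q q′} → p ℚ.< p′ → q ℚ.< q′ → mix t p q ℚ.< mix t p′ q′
  mix-mono-< {p} {p′} {q} {q′} p<p′ q<q′ with 0ℚ ℚ.<? t
  ... | yes 0<t =
    ℚ.+-mono-≤-< (ℚ.*-monoˡ-≤-nonNeg (1ℚ ℚ.- t) {{nonNegative (p≤q⇒0≤q-p t≤1)}} (ℚ.<⇒≤ p<p′))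
                 (ℚ.*-monoʳ-<-pos t {{positive 0<t}} q<q′)
  ... | no  0≮t with refl ← ℚ.≤-antisym 0≤t (ℚ.≮⇒≥ 0≮t) =
    subst₂ ℚ._<_ (sym (mix-0 p q)) (sym (mix-0 p′ q′)) p<p′

mix-gap : ∀ t p q r s → mix t p s ≡ mix t q r ℚ.+ (t ℚ.* ((q ℚ.- p) ℚ.+ (s ℚ.- r)) ℚ.- (q ℚ.- p))
mix-gap = solve 5 (λ t p q r s → (con 1ℚ :- t) :* p :+ t :* s :=
            ((con 1ℚ :- t) :* q :+ t :* r) :+ (t :* ((q :- p) :+ (s :- r)) :- (q :- p))) refl

segments-cross : ∀ {p q r s} → p ℚ.< q → r ℚ.< s →
                 ∃ λ t → 0ℚ ℚ.≤ t × t ℚ.≤ 1ℚ × mix t p s ≡ mix t q r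
segments-cross {p} {q} {r} {s} p<q r<s = t , 0≤t , t≤1 , crossing
  where
  α = q ℚ.- p
  β = s ℚ.- r
  0<α : 0ℚ ℚ.< α
  0<α = p<q⇒0<q-p p<q
  0<β : 0ℚ ℚ.< β
  0<β = p<q⇒0<q-p r<s
  instance
    α+β-pos : Positive (α ℚ.+ β)
    α+β-pos = positive (ℚ.+-mono-< 0<α 0<β)
    α+β-nonZero : NonZero (α ℚ.+ β)
    α+β-nonZero = ℚ.pos⇒nonZero (α ℚ.+ β)
    α-nonNeg : NonNegative α
    α-nonNeg = nonNegative (ℚ.<⇒≤ 0<α)
    inv-nonNeg : NonNegative (ℚ.1/ (α ℚ.+ β))
    inv-nonNeg = ℚ.pos⇒nonNeg (ℚ.1/ (α ℚ.+ β)) {{ℚ.1/pos⇒pos (α ℚ.+ β)}}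
  t = α ℚ.* ℚ.1/ (α ℚ.+ β)
  0≤t : 0ℚ ℚ.≤ t
  0≤t = subst (ℚ._≤ t) (ℚ.*-zeroʳ α) (ℚ.*-monoˡ-≤-nonNeg α (ℚ.nonNegative⁻¹ (ℚ.1/ (α ℚ.+ β))))
  t≤1 : t ℚ.≤ 1ℚ
  t≤1 = subst (t ℚ.≤_) (ℚ.*-inverseʳ (α ℚ.+ β)) (ℚ.*-monoʳ-≤-nonNeg (ℚ.1/ (α ℚ.+ β)) α≤α+β)
    where
    α≤α+β : α ℚ.≤ α ℚ.+ β
    α≤α+β = subst (ℚ._≤ α ℚ.+ β) (ℚ.+-identityʳ α) (ℚ.+-monoʳ-≤ α (ℚ.<⇒≤ 0<β))
  t*[α+β]≡α : t ℚ.* (α ℚ.+ β) ≡ α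
  t*[α+β]≡α =
    trans (ℚ.*-assoc α _ (α ℚ.+ β)) (trans (cong (α ℚ.*_) (ℚ.*-inverseˡ (α ℚ.+ β))) (ℚ.*-identityʳ α))
  crossing : mix t p s ≡ mix t q r
  crossing = begin
    mix t p s                                 ≡⟨ mix-gap t p q r s ⟩
    mix t q r ℚ.+ (t ℚ.* (α ℚ.+ β) ℚ.- α)     ≡⟨ cong (λ z → mix t q r ℚ.+ (z ℚ.- α)) t*[α+β]≡α ⟩
    mix t q r ℚ.+ (α ℚ.- α)                   ≡⟨ cong (mix t q r ℚ.+_) (ℚ.+-inverseʳ α) ⟩
    mix t q r ℚ.+ 0ℚ                          ≡⟨ ℚ.+-identityʳ (mix t q r) ⟩
    mix t q r                                 ∎
    where open ≡-Reasoning

0≤1 : 0ℚ ℚ.≤ 1ℚ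
0≤1 = ℚ.<⇒≤ (ℚ.positive⁻¹ 1ℚ)

module _ {n : ℕ} (T : TrapezoidFamily n) where

  LeftOf : Fin n → Fin n → Set
  LeftOf i j = (b T i ℚ.< a T j) × (d T i ℚ.< c T j)

  Intersect-sym : ∀ {i j} → Intersect T i j → Intersect T j i
  Intersect-sym (x , t , in-i , in-j) = x , t , in-j , in-i

  module _ (valid : ValidFamily T) where

    private
      a≤b : ∀ i → a T i ℚ.≤ b T i
      a≤b = proj₁ valid
      c≤d : ∀ i → c T i ℚ.≤ d T i
      c≤d = proj₁ (proj₂ valid)

    LeftOf-irrefl : ∀ {i} → ¬ LeftOf i i
    LeftOf-irrefl {i} (bi<ai , _) = ℚ.<-irrefl refl (ℚ.<-≤-trans bi<ai (a≤b i))

    LeftOf-trans : ∀ {i j k} → LeftOf i j → LeftOf j k → LeftOf i k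
    LeftOf-trans {j = j} (bi<aj , di<cj) (bj<ak , dj<ck) =
      ℚ.<-trans bi<aj (ℚ.≤-<-trans (a≤b j) bj<ak) , ℚ.<-trans di<cj (ℚ.≤-<-trans (c≤d j) dj<ck)

    LeftOf⇒¬Intersect : ∀ {i j} → LeftOf i j → ¬ Intersect T i j
    LeftOf⇒¬Intersect (bi<aj , di<cj) (x , t , (0≤t , t≤1 , _ , x≤right-i) , (_ , _ , left-j≤x , _)) =
      ℚ.<-irrefl refl (ℚ.≤-<-trans left-j≤x (ℚ.≤-<-trans x≤right-i (mix-mono-< 0≤t t≤1 di<cj bi<aj)))

    ∈top : ∀ i {x} → a T i ℚ.≤ x → x ℚ.≤ b T i → InTrapezoid T i x 1ℚ
    ∈top i {x} ai≤x x≤bi = 0≤1 , ℚ.≤-refl ,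
      subst (ℚ._≤ x) (sym (mix-1 (c T i) (a T i))) ai≤x , subst (x ℚ.≤_) (sym (mix-1 (d T i) (b T i))) x≤bi

    ∈bottom : ∀ i {x} → c T i ℚ.≤ x → x ℚ.≤ d T i → InTrapezoid T i x 0ℚ
    ∈bottom i {x} ci≤x x≤di = ℚ.≤-refl , 0≤1 ,
      subst (ℚ._≤ x) (sym (mix-0 (c T i) (a T i))) ci≤x , subst (x ℚ.≤_) (sym (mix-0 (d T i) (b T i))) x≤di

    top-overlap⇒Intersect : ∀ i j → a T j ℚ.≤ b T i → a T i ℚ.≤ b T j → Intersect T i j
    top-overlap⇒Intersect i j aj≤bi ai≤bj with ℚ.≤-total (a T i) (a T j)
    ... | inj₁ ai≤aj = a T j , 1ℚ , ∈top i ai≤aj aj≤bi , ∈top j ℚ.≤-refl (a≤b j)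
    ... | inj₂ aj≤ai = a T i , 1ℚ , ∈top i ℚ.≤-refl (a≤b i) , ∈top j aj≤ai ai≤bj

    bottom-overlap⇒Intersect : ∀ i j → c T j ℚ.≤ d T i → c T i ℚ.≤ d T j → Intersect T i j
    bottom-overlap⇒Intersect i j cj≤di ci≤dj with ℚ.≤-total (c T i) (c T j)
    ... | inj₁ ci≤cj = c T j , 0ℚ , ∈bottom i ci≤cj cj≤di , ∈bottom j ℚ.≤-refl (c≤d j)
    ... | inj₂ cj≤ci = c T i , 0ℚ , ∈bottom i ℚ.≤-refl (c≤d i) , ∈bottom j cj≤ci ci≤dj

    crossing⇒Intersect : ∀ i j → b T i ℚ.< a T j → d T j ℚ.< c T i → Intersect T i j
    crossing⇒Intersect i j bi<aj dj<ci =
      at-crossing (segments-cross (ℚ.≤-<-trans (c≤d j) (ℚ.<-≤-trans dj<ci (c≤d i))) bi<aj)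
      where
      at-crossing : (∃ λ t → 0ℚ ℚ.≤ t × t ℚ.≤ 1ℚ × mix t (c T j) (a T j) ≡ mix t (d T i) (b T i)) →
                    Intersect T i j
      at-crossing (t , 0≤t , t≤1 , left-j≡right-i) =
        mix t (d T i) (b T i) , t ,
        (0≤t , t≤1 , mix-mono-≤ 0≤t t≤1 (c≤d i) (a≤b i) , ℚ.≤-refl) ,
        (0≤t , t≤1 , ℚ.≤-reflexive left-j≡right-i ,
         subst (ℚ._≤ mix t (d T j) (b T j)) left-j≡right-i (mix-mono-≤ 0≤t t≤1 (c≤d j) (a≤b j)))

    top-separated : ∀ i j → ¬ Intersect T i j → b T i ℚ.< a T j ⊎ b T j ℚ.< a T i
    top-separated i j ¬int with b T i ℚ.<? a T j | b T j ℚ.<? a T i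
    ... | yes bi<aj | _         = inj₁ bi<aj
    ... | no  _     | yes bj<ai = inj₂ bj<ai
    ... | no  bi≮aj | no  bj≮ai = ⊥-elim (¬int (top-overlap⇒Intersect i j (ℚ.≮⇒≥ bi≮aj) (ℚ.≮⇒≥ bj≮ai)))

    bottom-separated : ∀ i j → ¬ Intersect T i j → d T i ℚ.< c T j ⊎ d T j ℚ.< c T i
    bottom-separated i j ¬int with d T i ℚ.<? c T j | d T j ℚ.<? c T i
    ... | yes di<cj | _         = inj₁ di<cj
    ... | no  _     | yes dj<ci = inj₂ dj<ci
    ... | no  di≮cj | no  dj≮ci = ⊥-elim (¬int (bottom-overlap⇒Intersect i j (ℚ.≮⇒≥ di≮cj) (ℚ.≮⇒≥ dj≮ci)))

    ¬Intersect⇒LeftOf : ∀ i j → ¬ Intersect T i j → LeftOf i j ⊎ LeftOf j i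
    ¬Intersect⇒LeftOf i j ¬int with top-separated i j ¬int | bottom-separated i j ¬int
    ... | inj₁ bi<aj | inj₁ di<cj = inj₁ (bi<aj , di<cj)
    ... | inj₂ bj<ai | inj₂ dj<ci = inj₂ (bj<ai , dj<ci)
    ... | inj₁ bi<aj | inj₂ dj<ci = ⊥-elim (¬int (crossing⇒Intersect i j bi<aj dj<ci))
    ... | inj₂ bj<ai | inj₁ di<cj = ⊥-elim (¬int (Intersect-sym (crossing⇒Intersect j i bj<ai di<cj)))

trapezoid⇒cocomparability : ∀ {n} {G : Graph n} → TrapezoidGraph G → CocomparabilityOrder G
trapezoid⇒cocomparability {G = G} (T , valid , adj⇔int) = record
  { _≺_      = LeftOf T
  ; ≺-irrefl = LeftOf-irrefl T valid
  ; ≺-trans  = LeftOf-trans T valid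
  ; ≺⇒¬Adj   = λ {i} {j} i≺j ij →
      LeftOf⇒¬Intersect T valid i≺j (Equivalence.to (adj⇔int i j (Adj⇒≢ G ij)) ij)
  ; ¬Adj⇒≺   = λ {i} {j} i≢j ¬ij →
      ¬Intersect⇒LeftOf T valid i j (λ int → ¬ij (Equivalence.from (adj⇔int i j i≢j) int))
  }

-- The spine

module Spine {n : ℕ} {G : Graph n} (acyclic : ¬ HasCycle G) (atMostTwo : AtMostTwoNonLeafNbrs G) where
  open Acyclic acyclic
  open DecMembership (_≟_ {n}) using (_∈?_)

  NonLeaf : Fin n → Set
  NonLeaf v = ¬ Leaf G v

  NonLeafPath : List (Fin n) → Set
  NonLeafPath s = Unique s × Consec G s × All NonLeaf s

  Extends : Fin n → List (Fin n) → Fin n → Set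
  Extends h t w = NonLeafNbr G h w × w ∉ t

  Extends? : ∀ h t w → Dec (Extends h t w)
  Extends? h t w = (Adj? G h w ×-dec ¬? (Leaf? G w)) ×-dec ¬? (w ∈? t)

  Stuck : Fin n → List (Fin n) → Set
  Stuck h t = ∀ {w} → NonLeafNbr G h w → w ∈ t

  data _↝_ : List (Fin n) → List (Fin n) → Set where
    done : ∀ {s} → s ↝ s
    grow : ∀ {h t w s} → Extends h t w → (w ∷ h ∷ t) ↝ s → (h ∷ t) ↝ s

  ↝-preserves : (P : List (Fin n) → Set) → (∀ {h t w} → P (h ∷ t) → Extends h t w → P (w ∷ h ∷ t)) →
                ∀ {s s′} → s ↝ s′ → P s → P s′
  ↝-preserves P preserved done             Ps = Ps
  ↝-preserves P preserved (grow ext grows) Ps = ↝-preserves P preserved grows (preserved Ps ext)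

  Unique-extend : ∀ {h t w} → Unique (h ∷ t) → Extends h t w → Unique (w ∷ h ∷ t)
  Unique-extend {t = t} uniq ((hw , _) , w∉t) = (≢-sym (Adj⇒≢ G hw) ∷ ¬Any⇒All¬ t w∉t) ∷ uniq

  NonLeafPath-extend : ∀ {h t w} → NonLeafPath (h ∷ t) → Extends h t w → NonLeafPath (w ∷ h ∷ t)
  NonLeafPath-extend (uniq , consec , nonLeaf) ext@((hw , ¬leaf) , _) =
    Unique-extend uniq ext , (Adj-sym G hw , consec) , ¬leaf ∷ nonLeaf

  maximal : ∀ k {h t} → Unique (h ∷ t) → n < length (h ∷ t) + k →
            ∃₂ λ h′ t′ → (h ∷ t) ↝ (h′ ∷ t′) × Stuck h′ t′
  maximal zero {h} {t} uniq n< =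
    ⊥-elim (<-irrefl refl (<-≤-trans (subst (n <_) (+-identityʳ _) n<) (Unique⇒length≤ₙ uniq)))
  maximal (suc k) {h} {t} uniq n< with any? (Extends? h t)
  ... | yes (w , ext) with h′ , t′ , grows , stuck ←
        maximal k (Unique-extend uniq ext) (subst (n <_) (+-suc _ k) n<) =
        h′ , t′ , grow ext grows , stuck
  ... | no ¬ext = h , t , done , stuck
    where
    stuck : Stuck h t
    stuck {w} nbr with w ∈? t
    ... | yes w∈t = w∈t
    ... | no  w∉t = ⊥-elim (¬ext (w , nbr , w∉t))

  maximalFrom : ∀ v → ∃₂ λ h t → (v ∷ []) ↝ (h ∷ t) × Stuck h t
  maximalFrom v = maximal n ([] ∷ []) (n<1+n n)

  End : Fin n → Set
  End e = ∀ {w w′} → NonLeafNbr G e w → NonLeafNbr G e w′ → w ≡ w′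

  stuck⇒End : ∀ {h t} → NonLeafPath (h ∷ t) → Stuck h t → End h
  stuck⇒End (uniq , consec , _) stuck nbr nbr′
    with _ , t≡  ← Adj⇒next uniq consec (proj₁ nbr) (stuck nbr)
       | _ , t≡′ ← Adj⇒next uniq consec (proj₁ nbr′) (stuck nbr′) = ∷-injectiveˡ (trans (sym t≡) t≡′)

  NbrsWithin : Fin n → List (Fin n) → Set
  NbrsWithin x s = ∀ {w} → NonLeafNbr G x w → w ∈ s

  Saturated : List (Fin n) → Set
  Saturated []          = ⊤
  Saturated (h ∷ [])    = End h
  Saturated (h ∷ x ∷ t) = All (λ y → NbrsWithin y (h ∷ x ∷ t)) (x ∷ t)

  Saturated-extend : ∀ {h t w} → NonLeafPath (h ∷ t) → Saturated (h ∷ t) → Extends h t w →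
                     Saturated (w ∷ h ∷ t)
  Saturated-extend {t = []} _ end (hw , _) = (λ hu → here (end hu hw)) ∷ []
  Saturated-extend {h} {x ∷ t} {w} (_ , (hx , _) , _ ∷ ¬leafx ∷ _) sat (hw , w∉t) =
    head-saturated ∷ All.map (λ within {_} nbr → there (within nbr)) sat
    where
    x≢w : x ≢ w
    x≢w refl = w∉t (here refl)
    head-saturated : NbrsWithin h (w ∷ h ∷ x ∷ t)
    head-saturated {u} hu with u ≟ x | u ≟ w
    ... | yes refl | _        = there (there (here refl))
    ... | no  _    | yes refl = here refl
    ... | no  u≢x  | no  u≢w  = ⊥-elim (atMostTwo (hx , ¬leafx) hw hu x≢w (≢-sym u≢x) (≢-sym u≢w))

  saturated⇒within : ∀ {h t} → Saturated (h ∷ t) → Stuck h t → ∀ {x} → x ∈ h ∷ t → NbrsWithin x (h ∷ t)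
  saturated⇒within             _   stuck (here refl) nbr = there (stuck nbr)
  saturated⇒within {t = _ ∷ _} sat _     (there x∈t) nbr = All.lookup sat x∈t nbr

  -- the list together with the leaves hanging off it is closed under adjacency
  within⇒∋nonLeaves : Connected G → ∀ {h t} → (∀ {x} → x ∈ h ∷ t → NbrsWithin x (h ∷ t)) →
                      ∀ {v} → NonLeaf v → v ∈ h ∷ t
  within⇒∋nonLeaves connected {h} {t} within {v} ¬leaf
    with Reach-preserves G Attached closed (connected h v) (inj₁ (here refl))
    where
    Attached : Fin n → Set
    Attached x = x ∈ h ∷ t ⊎ (Leaf G x × ∃ λ y → Adj G x y × y ∈ h ∷ t)
    closed : ∀ {x y} → Attached x → Adj G x y → Attached y
    closed {y = y} (inj₁ x∈) xy with Leaf? G y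
    ... | yes leaf  = inj₂ (leaf , _ , Adj-sym G xy , x∈)
    ... | no  ¬leaf = inj₁ (within x∈ (xy , ¬leaf))
    closed (inj₂ (leaf , _ , xz , z∈)) xy = inj₁ (subst (_∈ h ∷ t) (Leaf⇒Adj-unique G leaf xz xy) z∈)
  ... | inj₁ v∈         = v∈
  ... | inj₂ (leaf , _) = ⊥-elim (¬leaf leaf)

  leafDeletionIsPath : Connected G → LeafDeletionIsPath G
  leafDeletionIsPath connected with any? (λ v → ¬? (Leaf? G v))
  ... | no noNonLeaf = [] , [] , (λ v → mk⇔ (λ ()) (λ ¬leaf → ⊥-elim (noNonLeaf (v , ¬leaf)))) , λ _ _ ()
  ... | yes (r , ¬leafr)
    with e , t₁ , r↝ , stuck₁ ← maximalFrom r
    with path₁@(_ , _ , ¬leafe ∷ _) ←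
      ↝-preserves NonLeafPath NonLeafPath-extend r↝ ([] ∷ [] , tt , ¬leafr ∷ [])
    with h , t , e↝ , stuck ← maximalFrom e
    with (uniq , consec , nonLeaves) , sat ←
      ↝-preserves (λ s → NonLeafPath s × Saturated s)
        (λ (path , sat) ext → NonLeafPath-extend path ext , Saturated-extend path sat ext)
        e↝ (([] ∷ [] , tt , ¬leafe ∷ []) , stuck⇒End path₁ stuck₁) =
    h ∷ t , uniq ,
    (λ v → mk⇔ (All.lookup nonLeaves) (within⇒∋nonLeaves connected (saturated⇒within sat stuck))) ,
    λ u v u∈ v∈ → Adj⇔ConsecutiveIn uniq consec u∈ v∈

atMostTwoNonLeafNbrs⇒LeafDeletionIsPath : ∀ {n} {G : Graph n} → Connected G → ¬ HasCycle G →
                                          AtMostTwoNonLeafNbrs G → LeafDeletionIsPath G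
atMostTwoNonLeafNbrs⇒LeafDeletionIsPath connected acyclic atMostTwo =
  Spine.leafDeletionIsPath acyclic atMostTwo connected

-- Caterpillars are interval graphs

record IntervalModel {n : ℕ} (G : Graph n) : Set where
  field
    lo hi         : Fin n → ℕ
    lo≤hi         : ∀ i → lo i ≤ hi i
    separated     : ∀ {i j} → i ≢ j → lo i ≢ lo j × lo i ≢ hi j × hi i ≢ hi j
    Adj⇔overlap   : ∀ {i j} → i ≢ j → Adj G i j ⇔ (lo i ≤ hi j × lo j ≤ hi i)

toℚ : ℕ → ℚ
toℚ k = fromℤ (+ k)

toℚ-mono-≤ : ∀ {k l} → k ≤ l → toℚ k ℚ.≤ toℚ l
toℚ-mono-≤ {k} {l} k≤l = *≤* (subst₂ ℤ._≤_ (sym (ℤ.*-identityʳ (+ k))) (sym (ℤ.*-identityʳ (+ l))) (ℤ.+≤+ k≤l))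

toℚ-cancel-≤ : ∀ {k l} → toℚ k ℚ.≤ toℚ l → k ≤ l
toℚ-cancel-≤ {k} {l} (*≤* k≤l) = ℤ.drop‿+≤+ (subst₂ ℤ._≤_ (ℤ.*-identityʳ (+ k)) (ℤ.*-identityʳ (+ l)) k≤l)

toℚ-injective : ∀ {k l} → toℚ k ≡ toℚ l → k ≡ l
toℚ-injective k≡l = ℤ.+-injective (cong ↥_ k≡l)

mix-same : ∀ t p → mix t p p ≡ p
mix-same = solve 2 (λ t p → (con 1ℚ :- t) :* p :+ t :* p := p) refl

interval⇒trapezoid : ∀ {n} {G : Graph n} → IntervalModel G → TrapezoidGraph G
interval⇒trapezoid {n} {G} M = T , valid , λ i j i≢j → mk⇔
  (λ ij → Equivalence.from (Intersect⇔overlap i j) (Equivalence.to (Adj⇔overlap i≢j) ij))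
  (λ int → Equivalence.from (Adj⇔overlap i≢j) (Equivalence.to (Intersect⇔overlap i j) int))
  where
  open IntervalModel M
  T : TrapezoidFamily n
  T = record { a = toℚ ∘ lo ; b = toℚ ∘ hi ; c = toℚ ∘ lo ; d = toℚ ∘ hi }

  valid : ValidFamily T
  valid = (λ i → toℚ-mono-≤ (lo≤hi i)) , (λ i → toℚ-mono-≤ (lo≤hi i)) , λ i j i≢j →
    let (lo≢lo , lo≢hi , hi≢hi) = separated i≢j
        (_ , lo≢hi′ , _)       = separated (≢-sym i≢j)
        ll = λ e → lo≢lo (toℚ-injective e)
        lh = λ e → lo≢hi (toℚ-injective e)
        hl = λ e → lo≢hi′ (sym (toℚ-injective e))
        hh = λ e → hi≢hi (toℚ-injective e)
    in ll , lh , hl , hh , ll , lh , hl , hh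

  ∈T : ∀ i {x} → lo i ≤ x → x ≤ hi i → InTrapezoid T i (toℚ x) 0ℚ
  ∈T i {x} lo≤x x≤hi = ℚ.≤-refl , 0≤1 ,
    subst (ℚ._≤ toℚ x) (sym (mix-same 0ℚ (toℚ (lo i)))) (toℚ-mono-≤ lo≤x) ,
    subst (toℚ x ℚ.≤_) (sym (mix-same 0ℚ (toℚ (hi i)))) (toℚ-mono-≤ x≤hi)

  Intersect⇔overlap : ∀ i j → Intersect T i j ⇔ (lo i ≤ hi j × lo j ≤ hi i)
  Intersect⇔overlap i j = mk⇔ to from
    where
    bounds : ∀ {k l x t} → mix t (toℚ (lo k)) (toℚ (lo k)) ℚ.≤ x → x ℚ.≤ mix t (toℚ (hi l)) (toℚ (hi l)) →
             lo k ≤ hi l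
    bounds {k} {l} {x} {t} lo≤x x≤hi =
      toℚ-cancel-≤ (ℚ.≤-trans (subst (ℚ._≤ x) (mix-same t _) lo≤x) (subst (x ℚ.≤_) (mix-same t _) x≤hi))
    to : Intersect T i j → lo i ≤ hi j × lo j ≤ hi i
    to (x , t , (_ , _ , loi≤x , x≤hii) , (_ , _ , loj≤x , x≤hij)) =
      bounds {i} {j} {x} {t} loi≤x x≤hij , bounds {j} {i} {x} {t} loj≤x x≤hii
    from : lo i ≤ hi j × lo j ≤ hi i → Intersect T i j
    from (loi≤hij , loj≤hii) with ≤-total (lo i) (lo j)
    ... | inj₁ loi≤loj = toℚ (lo j) , 0ℚ , ∈T i loi≤loj loj≤hii , ∈T j ≤-refl (lo≤hi j)
    ... | inj₂ loj≤loi = toℚ (lo i) , 0ℚ , ∈T i ≤-refl (lo≤hi i) , ∈T j loj≤loi loi≤hij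

-- K q + r, read as the digits (q , r) in base K
module Lexicographic (K : ℕ) where

  ⟨_,_⟩ : ℕ → ℕ → ℕ
  ⟨ q , r ⟩ = K * q + r

  ⟨⟩-<-carry : ∀ {q r} → r < K → ⟨ q , r ⟩ < K * suc q
  ⟨⟩-<-carry {q} {r} r<K =
    subst (⟨ q , r ⟩ <_) (trans (+-comm (K * q) K) (sym (*-suc K q))) (+-monoʳ-< (K * q) r<K)

  ⟨⟩-monoʳ-≤ : ∀ {q r r′} → r ≤ r′ → ⟨ q , r ⟩ ≤ ⟨ q , r′ ⟩
  ⟨⟩-monoʳ-≤ {q} = +-monoʳ-≤ (K * q)

  ⟨⟩-<⇒≤ : ∀ {q q′ r r′} → q < q′ → r < K → ⟨ q , r ⟩ ≤ ⟨ q′ , r′ ⟩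
  ⟨⟩-<⇒≤ {q} {q′} {r} {r′} q<q′ r<K =
    ≤-trans (<⇒≤ (⟨⟩-<-carry r<K)) (≤-trans (*-monoʳ-≤ K q<q′) (m≤m+n (K * q′) r′))

  ⟨⟩-≤⁻ : ∀ {q q′ r r′} → r′ < K → ⟨ q , r ⟩ ≤ ⟨ q′ , r′ ⟩ → q < q′ ⊎ (q ≡ q′ × r ≤ r′)
  ⟨⟩-≤⁻ {q} {q′} {r} {r′} r′<K qr≤ with <-cmp q q′
  ... | tri< q<q′ _ _ = inj₁ q<q′
  ... | tri≈ _ refl _ = inj₂ (refl , +-cancelˡ-≤ (K * q) r r′ qr≤)
  ... | tri> _ _ q′<q = ⊥-elim (<⇒≱ (<-≤-trans (⟨⟩-<-carry r′<K) (*-monoʳ-≤ K q′<q))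
                                       (≤-trans (m≤m+n (K * q) r) qr≤))

  ⟨⟩-injective : ∀ {q q′ r r′} → r < K → r′ < K → ⟨ q , r ⟩ ≡ ⟨ q′ , r′ ⟩ → q ≡ q′ × r ≡ r′
  ⟨⟩-injective r<K r′<K eq with ⟨⟩-≤⁻ r′<K (≤-reflexive eq) | ⟨⟩-≤⁻ r<K (≤-reflexive (sym eq))
  ... | inj₁ q<q′       | inj₁ q′<q        = ⊥-elim (<-asym q<q′ q′<q)
  ... | inj₁ q<q′       | inj₂ (q′≡q , _)  = ⊥-elim (<-irrefl (sym q′≡q) q<q′)
  ... | inj₂ (q≡q′ , _) | inj₁ q′<q        = ⊥-elim (<-irrefl (sym q≡q′) q′<q)
  ... | inj₂ (q≡q′ , r≤r′) | inj₂ (_ , r′≤r) = q≡q′ , ≤-antisym r≤r′ r′≤r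

  ⟨⟩-≢ˡ : ∀ q q′ {r r′} → r < K → r′ < K → q ≢ q′ → ⟨ q , r ⟩ ≢ ⟨ q′ , r′ ⟩
  ⟨⟩-≢ˡ _ _ r<K r′<K q≢q′ eq = q≢q′ (proj₁ (⟨⟩-injective r<K r′<K eq))

  ⟨⟩-≢ʳ : ∀ q q′ {r r′} → r < K → r′ < K → r ≢ r′ → ⟨ q , r ⟩ ≢ ⟨ q′ , r′ ⟩
  ⟨⟩-≢ʳ _ _ r<K r′<K r≢r′ eq = r≢r′ (proj₂ (⟨⟩-injective r<K r′<K eq))

module Positions {A : Set} (_≟_ : DecidableEquality A) where

  position : A → List A → ℕ
  position x []       = 0
  position x (y ∷ ys) with x ≟ y
  ... | yes _ = 0
  ... | no  _ = suc (position x ys)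

  position-injective : ∀ {xs u v} → u ∈ xs → v ∈ xs → position u xs ≡ position v xs → u ≡ v
  position-injective {y ∷ ys} {u} {v} u∈ v∈ eq with u ≟ y | v ≟ y
  ... | yes u≡y | yes v≡y = trans u≡y (sym v≡y)
  ... | yes _   | no  _   = ⊥-elim (0≢1+n eq)
  ... | no  _   | yes _   = ⊥-elim (0≢1+n (sym eq))
  ... | no  u≢y | no  v≢y = position-injective (tail u≢y u∈) (tail v≢y v∈) (suc-injective eq)
    where
    tail : ∀ {x} → x ≢ y → x ∈ y ∷ ys → x ∈ ys
    tail x≢y (here x≡y) = ⊥-elim (x≢y x≡y)
    tail _   (there x∈) = x∈

  position-here : ∀ x ys → position x (x ∷ ys) ≡ 0
  position-here x ys with x ≟ x
  ... | yes _   = refl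
  ... | no  x≢x = ⊥-elim (x≢x refl)

  position-there : ∀ {x y} ys → x ≢ y → position x (y ∷ ys) ≡ suc (position x ys)
  position-there {x} {y} ys x≢y with x ≟ y
  ... | yes x≡y = ⊥-elim (x≢y x≡y)
  ... | no  _   = refl

  position-consecutive : ∀ xs {u v ys} → Unique (xs ++ u ∷ v ∷ ys) →
                         position v (xs ++ u ∷ v ∷ ys) ≡ suc (position u (xs ++ u ∷ v ∷ ys))
  position-consecutive [] {u} {v} {ys} ((u≢v ∷ _) ∷ _) =
    trans (position-there (v ∷ ys) (≢-sym u≢v))
          (cong suc (trans (position-here v ys) (sym (position-here u (v ∷ ys)))))
  position-consecutive (x ∷ xs) {u} {v} {ys} (x∉ ∷ uniq) =
    trans (position-there _ (∉ x∉ (there (here refl))))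
          (cong suc (trans (position-consecutive xs uniq) (sym (position-there _ (∉ x∉ (here refl))))))
    where
    ∉ : ∀ {z} → All (x ≢_) (xs ++ u ∷ v ∷ ys) → z ∈ u ∷ v ∷ ys → z ≢ x
    ∉ x∉ z∈ z≡x = All.lookup x∉ (∈-++⁺ʳ xs z∈) (sym z≡x)

  position≡0⇒head : ∀ {x xs} → x ∈ xs → position x xs ≡ 0 → ∃ λ ys → xs ≡ x ∷ ys
  position≡0⇒head {x} {y ∷ ys} _ eq with x ≟ y
  ... | yes refl = ys , refl

  successive⇒consecutive : ∀ {xs u v} → Unique xs → u ∈ xs → v ∈ xs →
                           position v xs ≡ suc (position u xs) → ∃₂ λ ys zs → xs ≡ ys ++ u ∷ v ∷ zs
  successive⇒consecutive {v ∷ ys} _ _ (here refl) eq =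
    ⊥-elim (0≢1+n (trans (sym (position-here v ys)) eq))
  successive⇒consecutive {u ∷ ys} {u} {v} (u∉ ∷ _) (here refl) (there v∈) eq =
    [] , proj₁ v-next , cong (u ∷_) (proj₂ v-next)
    where
    v≢u : v ≢ u
    v≢u v≡u = All.lookup u∉ v∈ (sym v≡u)
    v-next : ∃ λ zs → ys ≡ v ∷ zs
    v-next = position≡0⇒head v∈
      (suc-injective (trans (sym (position-there ys v≢u)) (trans eq (cong suc (position-here u ys)))))
  successive⇒consecutive {y ∷ ys} {u} {v} (y∉ ∷ uniq) (there u∈) (there v∈) eq =
    y ∷ proj₁ split , proj₁ (proj₂ split) , cong (y ∷_) (proj₂ (proj₂ split))
    where
    ≢y : ∀ {z} → z ∈ ys → z ≢ y
    ≢y z∈ z≡y = All.lookup y∉ z∈ (sym z≡y)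
    split : ∃₂ λ xs zs → ys ≡ xs ++ u ∷ v ∷ zs
    split = successive⇒consecutive uniq u∈ v∈
      (suc-injective (trans (sym (position-there ys (≢y v∈))) (trans eq (cong suc (position-there ys (≢y u∈))))))

data Piece : Set where
  spine   : ℕ → Piece
  pendant : ℕ → ℕ → Piece

-- Spine position a becomes the interval [⟨ a , 0 ⟩ , ⟨ a + 1 , 1 ⟩], which meets its two
-- neighbours only near its ends; a pendant vertex with label t < m at spine position b becomes
-- the point ⟨ b , 2 + t ⟩, which only the interval of b covers.
module Layout (m : ℕ) where
  open Lexicographic (2 + m)

  lo hi : Piece → ℕ
  lo (spine a)     = ⟨ a , 0 ⟩
  lo (pendant b t) = ⟨ b , 2 + t ⟩
  hi (spine a)     = ⟨ suc a , 1 ⟩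
  hi (pendant b t) = ⟨ b , 2 + t ⟩

  Overlap : Piece → Piece → Set
  Overlap P Q = lo P ≤ hi Q × lo Q ≤ hi P

  Separated : Piece → Piece → Set
  Separated P Q = lo P ≢ lo Q × lo P ≢ hi Q × hi P ≢ hi Q

  private
    0<K : 0 < 2 + m
    0<K = s≤s z≤n
    1<K : 1 < 2 + m
    1<K = s≤s (s≤s z≤n)
    2+t<K : ∀ {t} → t < m → 2 + t < 2 + m
    2+t<K t<m = s≤s (s≤s t<m)

  lo≤hi : ∀ P → lo P ≤ hi P
  lo≤hi (spine a)     = ⟨⟩-<⇒≤ {r′ = 1} (n<1+n a) 0<K
  lo≤hi (pendant _ _) = ≤-refl

  spine-overlap : ∀ {a a′} → a ≢ a′ → Overlap (spine a) (spine a′) ⇔ (a′ ≡ suc a ⊎ a ≡ suc a′)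
  spine-overlap {a} {a′} a≢a′ = mk⇔ to from
    where
    to : Overlap (spine a) (spine a′) → a′ ≡ suc a ⊎ a ≡ suc a′
    to (≤a′ , ≤a) with ⟨⟩-≤⁻ 1<K ≤a′ | ⟨⟩-≤⁻ 1<K ≤a
    ... | inj₂ (a≡ , _) | _              = inj₂ a≡
    ... | _             | inj₂ (a′≡ , _) = inj₁ a′≡
    ... | inj₁ a<       | inj₁ a′<       = ⊥-elim (a≢a′ (≤-antisym (≤-pred a<) (≤-pred a′<)))
    from : a′ ≡ suc a ⊎ a ≡ suc a′ → Overlap (spine a) (spine a′)
    from (inj₁ refl) = ⟨⟩-<⇒≤ {r′ = 1} (m<n⇒m<1+n (n<1+n a)) 0<K , ⟨⟩-monoʳ-≤ {suc a} z≤n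
    from (inj₂ refl) = ⟨⟩-monoʳ-≤ {suc a′} z≤n , ⟨⟩-<⇒≤ {r′ = 1} (m<n⇒m<1+n (n<1+n a′)) 0<K

  spine-pendant-overlap : ∀ a b {t} → t < m → Overlap (spine a) (pendant b t) ⇔ a ≡ b
  spine-pendant-overlap a b {t} t<m = mk⇔ to from
    where
    to : Overlap (spine a) (pendant b t) → a ≡ b
    to (≤b , b≤) with ⟨⟩-≤⁻ (2+t<K t<m) ≤b | ⟨⟩-≤⁻ 1<K b≤
    ... | _               | inj₂ (_ , 2+t≤1) = ⊥-elim (<⇒≱ (s≤s (s≤s z≤n)) 2+t≤1)
    ... | inj₂ (a≡b , _)  | _                = a≡b
    ... | inj₁ a<b        | inj₁ b<1+a       = ⊥-elim (<⇒≱ a<b (≤-pred b<1+a))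
    from : a ≡ b → Overlap (spine a) (pendant b t)
    from refl = ⟨⟩-monoʳ-≤ {a} z≤n , ⟨⟩-<⇒≤ {r′ = 1} (n<1+n a) (2+t<K t<m)

  pendant-pendant-¬overlap : ∀ b b′ {t t′} → t < m → t′ < m → t ≢ t′ →
                             ¬ Overlap (pendant b t) (pendant b′ t′)
  pendant-pendant-¬overlap b b′ t<m t′<m t≢t′ (≤b′ , ≤b) =
    ⟨⟩-≢ʳ b b′ (2+t<K t<m) (2+t<K t′<m) (λ e → t≢t′ (+-cancelˡ-≡ 2 _ _ e)) (≤-antisym ≤b′ ≤b)

  spine-separated : ∀ {a a′} → a ≢ a′ → Separated (spine a) (spine a′)
  spine-separated {a} {a′} a≢a′ =
    ⟨⟩-≢ˡ a a′ 0<K 0<K a≢a′ , ⟨⟩-≢ʳ a (suc a′) 0<K 1<K (λ ()) ,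
    ⟨⟩-≢ˡ (suc a) (suc a′) 1<K 1<K (λ e → a≢a′ (suc-injective e))

  spine-pendant-separated : ∀ a b {t} → t < m → Separated (spine a) (pendant b t)
  spine-pendant-separated a b t<m =
    ⟨⟩-≢ʳ a b 0<K (2+t<K t<m) (λ ()) , ⟨⟩-≢ʳ a b 0<K (2+t<K t<m) (λ ()) ,
    ⟨⟩-≢ʳ (suc a) b 1<K (2+t<K t<m) (λ ())

  pendant-spine-separated : ∀ a b {t} → t < m → Separated (pendant b t) (spine a)
  pendant-spine-separated a b t<m =
    ⟨⟩-≢ʳ b a (2+t<K t<m) 0<K (λ ()) , ⟨⟩-≢ʳ b (suc a) (2+t<K t<m) 1<K (λ ()) ,
    ⟨⟩-≢ʳ b (suc a) (2+t<K t<m) 1<K (λ ())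

  pendant-separated : ∀ b b′ {t t′} → t < m → t′ < m → t ≢ t′ →
                      Separated (pendant b t) (pendant b′ t′)
  pendant-separated b b′ t<m t′<m t≢t′ = ≢ , ≢ , ≢
    where
    ≢ = ⟨⟩-≢ʳ b b′ (2+t<K t<m) (2+t<K t′<m) (λ e → t≢t′ (+-cancelˡ-≡ 2 _ _ e))

complete⇒IntervalModel : ∀ {n} {G : Graph n} → (∀ {i j} → i ≢ j → Adj G i j) → IntervalModel G
complete⇒IntervalModel {n} complete = record
  { lo          = toℕ
  ; hi          = λ i → n + toℕ i
  ; lo≤hi       = λ i → m≤n+m (toℕ i) n
  ; separated   = λ {i} {j} i≢j →
      (λ e → i≢j (toℕ-injective e)) ,
      (λ e → <-irrefl e (<-≤-trans (toℕ<n i) (m≤m+n n (toℕ j)))) ,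
      (λ e → i≢j (toℕ-injective (+-cancelˡ-≡ n _ _ e)))
  ; Adj⇔overlap = λ {i} {j} i≢j → mk⇔
      (λ _ → ≤-trans (<⇒≤ (toℕ<n i)) (m≤m+n n (toℕ j)) , ≤-trans (<⇒≤ (toℕ<n j)) (m≤m+n n (toℕ i)))
      (λ _ → complete i≢j)
  }

module CaterpillarModel {n : ℕ} {G : Graph n} (connected : Connected G) (p : List (Fin n)) (uniq : Unique p)
                        (∈p⇔¬Leaf : ∀ v → v ∈ p ⇔ (¬ Leaf G v))
                        (Adj⇔ConsecutiveIn : ∀ u v → u ∈ p → v ∈ p → Adj G u v ⇔ ConsecutiveIn G u v p)
                        where
  open Positions (_≟_ {n})
  open Layout n
  open DecMembership (_≟_ {n}) using (_∈?_)

  ∉⇒Leaf : ∀ {v} → v ∉ p → Leaf G v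
  ∉⇒Leaf {v} v∉ with Leaf? G v
  ... | yes leaf  = leaf
  ... | no  ¬leaf = ⊥-elim (v∉ (Equivalence.from (∈p⇔¬Leaf v) ¬leaf))

  -- the neighbour of a leaf (junk for other vertices)
  anchor : Fin n → Fin n
  anchor v with any? (Adj? G v)
  ... | yes (w , _) = w
  ... | no  _       = v

  Leaf⇒Adj-anchor : ∀ {v} → Leaf G v → Adj G v (anchor v)
  Leaf⇒Adj-anchor {v} leaf with any? (Adj? G v)
  ... | yes (_ , vw) = vw
  ... | no  none     = ⊥-elim (none (Leaf⇒∃Adj G leaf))

  Successive : Fin n → Fin n → Set
  Successive u v = position v p ≡ suc (position u p) ⊎ position u p ≡ suc (position v p)

  ConsecutiveIn⇔Successive : ∀ {u v} → u ∈ p → v ∈ p → ConsecutiveIn G u v p ⇔ Successive u v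
  ConsecutiveIn⇔Successive {u} {v} u∈ v∈ = mk⇔ to from
    where
    successive : ∀ {x y} xs {ys} → p ≡ xs ++ x ∷ y ∷ ys → position y p ≡ suc (position x p)
    successive {x} {y} xs p≡ =
      subst (λ l → position y l ≡ suc (position x l)) (sym p≡) (position-consecutive xs (subst Unique p≡ uniq))
    to : ConsecutiveIn G u v p → Successive u v
    to (xs , _ , inj₁ p≡) = inj₁ (successive xs p≡)
    to (xs , _ , inj₂ p≡) = inj₂ (successive xs p≡)
    from : Successive u v → ConsecutiveIn G u v p
    from (inj₁ v≡) with xs , ys , p≡ ← successive⇒consecutive uniq u∈ v∈ v≡ = xs , ys , inj₁ p≡
    from (inj₂ u≡) with xs , ys , p≡ ← successive⇒consecutive uniq v∈ u∈ u≡ = xs , ys , inj₂ p≡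

  module _ {x₀ : Fin n} (x₀∈ : x₀ ∈ p) where

    ¬Adj-leaves : ∀ {v w} → v ∉ p → w ∉ p → ¬ Adj G v w
    ¬Adj-leaves v∉ w∉ vw with adjacent-leaves-cover G connected (∉⇒Leaf v∉) (∉⇒Leaf w∉) vw x₀
    ... | inj₁ refl = v∉ x₀∈
    ... | inj₂ refl = w∉ x₀∈

    anchor-∈ : ∀ {v} → v ∉ p → anchor v ∈ p
    anchor-∈ {v} v∉ with anchor v ∈? p
    ... | yes a∈ = a∈
    ... | no  a∉ = ⊥-elim (¬Adj-leaves v∉ a∉ (Leaf⇒Adj-anchor (∉⇒Leaf v∉)))

    pieceOf : ∀ v → Dec (v ∈ p) → Piece
    pieceOf v (yes _) = spine (position v p)
    pieceOf v (no  _) = pendant (position (anchor v) p) (toℕ v)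

    pieces-separated : ∀ {i j} (i? : Dec (i ∈ p)) (j? : Dec (j ∈ p)) → i ≢ j →
                       Separated (pieceOf i i?) (pieceOf j j?)
    pieces-separated (yes i∈) (yes j∈) i≢j = spine-separated (λ e → i≢j (position-injective i∈ j∈ e))
    pieces-separated {i} {j} (yes _) (no  _) _ =
      spine-pendant-separated (position i p) (position (anchor j) p) (toℕ<n j)
    pieces-separated {i} {j} (no  _) (yes _) _ =
      pendant-spine-separated (position j p) (position (anchor i) p) (toℕ<n i)
    pieces-separated {i} {j} (no  _) (no  _) i≢j =
      pendant-separated (position (anchor i) p) (position (anchor j) p) (toℕ<n i) (toℕ<n j)
        (λ e → i≢j (toℕ-injective e))

    spine-pendant-Adj⇔overlap : ∀ {i j} (i∈ : i ∈ p) (j∉ : j ∉ p) →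
                                Adj G i j ⇔ Overlap (pieceOf i (yes i∈)) (pieceOf j (no j∉))
    spine-pendant-Adj⇔overlap {i} {j} i∈ j∉ = begin
      Adj G i j                             ≈⟨ mk⇔ (λ ij → Leaf⇒Adj-unique G leafj (Adj-sym G ij) j-anchor)
                                                   (λ { refl → Adj-sym G j-anchor }) ⟩
      i ≡ anchor j                          ≈⟨ mk⇔ (cong (λ v → position v p))
                                                   (position-injective i∈ (anchor-∈ j∉)) ⟩
      position i p ≡ position (anchor j) p  ≈⟨ spine-pendant-overlap (position i p) (position (anchor j) p)
                                                                     (toℕ<n j) ⟨
      Overlap (spine (position i p)) (pendant (position (anchor j) p) (toℕ j)) ∎
      where
      open ⇔-Reasoning
      leafj : Leaf G j
      leafj = ∉⇒Leaf j∉
      j-anchor : Adj G j (anchor j)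
      j-anchor = Leaf⇒Adj-anchor leafj

    pieces-Adj⇔overlap : ∀ {i j} (i? : Dec (i ∈ p)) (j? : Dec (j ∈ p)) → i ≢ j →
                         Adj G i j ⇔ Overlap (pieceOf i i?) (pieceOf j j?)
    pieces-Adj⇔overlap {i} {j} (yes i∈) (yes j∈) i≢j = begin
      Adj G i j                                            ≈⟨ Adj⇔ConsecutiveIn i j i∈ j∈ ⟩
      ConsecutiveIn G i j p                                ≈⟨ ConsecutiveIn⇔Successive i∈ j∈ ⟩
      Successive i j                                       ≈⟨ spine-overlap (λ e → i≢j (position-injective i∈ j∈ e)) ⟨
      Overlap (spine (position i p)) (spine (position j p)) ∎
      where open ⇔-Reasoning
    pieces-Adj⇔overlap (yes i∈) (no j∉) _ = spine-pendant-Adj⇔overlap i∈ j∉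
    pieces-Adj⇔overlap {i} {j} (no i∉) (yes j∈) _ = begin
      Adj G i j                                                              ≈⟨ mk⇔ (Adj-sym G) (Adj-sym G) ⟩
      Adj G j i                                                              ≈⟨ spine-pendant-Adj⇔overlap j∈ i∉ ⟩
      Overlap (spine (position j p)) (pendant (position (anchor i) p) (toℕ i)) ≈⟨ mk⇔ swap swap ⟩
      Overlap (pendant (position (anchor i) p) (toℕ i)) (spine (position j p)) ∎
      where open ⇔-Reasoning
    pieces-Adj⇔overlap {i} {j} (no i∉) (no j∉) i≢j = mk⇔
      (λ ij → ⊥-elim (¬Adj-leaves i∉ j∉ ij))
      (λ ov → ⊥-elim (pendant-pendant-¬overlap (position (anchor i) p) (position (anchor j) p)
                             (toℕ<n i) (toℕ<n j) (λ e → i≢j (toℕ-injective e)) ov))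

    model : IntervalModel G
    model = record
      { lo          = λ v → lo (pieceOf v (v ∈? p))
      ; hi          = λ v → hi (pieceOf v (v ∈? p))
      ; lo≤hi       = λ v → lo≤hi (pieceOf v (v ∈? p))
      ; separated   = λ {i} {j} → pieces-separated (i ∈? p) (j ∈? p)
      ; Adj⇔overlap = λ {i} {j} → pieces-Adj⇔overlap (i ∈? p) (j ∈? p)
      }

  -- without a spine the tree is a single edge
  spineless⇒complete : (∀ v → v ∉ p) → ∀ {i j} → i ≢ j → Adj G i j
  spineless⇒complete ∉p {i} {j} i≢j
    with adjacent-leaves-cover G connected (∉⇒Leaf (∉p i)) (∉⇒Leaf (∉p (anchor i)))
           (Leaf⇒Adj-anchor (∉⇒Leaf (∉p i))) j
  ... | inj₁ refl = ⊥-elim (i≢j refl)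
  ... | inj₂ refl = Leaf⇒Adj-anchor (∉⇒Leaf (∉p i))

caterpillar⇒IntervalModel : ∀ {n} {G : Graph n} → Connected G → LeafDeletionIsPath G → IntervalModel G
caterpillar⇒IntervalModel connected ([] , uniq , ∈p⇔¬Leaf , Adj⇔ConsecutiveIn) =
  complete⇒IntervalModel
    (CaterpillarModel.spineless⇒complete connected [] uniq ∈p⇔¬Leaf Adj⇔ConsecutiveIn (λ _ ()))
caterpillar⇒IntervalModel connected (x₀ ∷ p , uniq , ∈p⇔¬Leaf , Adj⇔ConsecutiveIn) =
  CaterpillarModel.model connected (x₀ ∷ p) uniq ∈p⇔¬Leaf Adj⇔ConsecutiveIn (here refl)

theorem4 : (n : ℕ) (G : Graph n) → Tree G → (TrapezoidGraph G ⇔ Caterpillar G)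
theorem4 n G tree@(_ , connected , acyclic) = mk⇔ trapezoid⇒caterpillar caterpillar⇒trapezoid
  where
  trapezoid⇒caterpillar : TrapezoidGraph G → Caterpillar G
  trapezoid⇒caterpillar trapezoid =
    tree , atMostTwoNonLeafNbrs⇒LeafDeletionIsPath connected acyclic
             (Arms.AT-free⇒AtMostTwoNonLeafNbrs acyclic
               (¬AsteroidalTriple G (trapezoid⇒cocomparability trapezoid)))
  caterpillar⇒trapezoid : Caterpillar G → TrapezoidGraph G
  caterpillar⇒trapezoid (_ , leafDeletion) =
    interval⇒trapezoid (caterpillar⇒IntervalModel connected leafDeletion)
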